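{- Let $n\ge 2$ and let $S$ and $T$ be distinct non-empty subsets of $[n-1]$ such that $S\subseteq T$, $\min(S)+\max(S)\le n$ and $\max(T\setminus S)<\min(S)$. Then two flags of $[n]$ of type $T$ are in general position if and only if their images under $\mathrm{proj}^n_{T,S}$ are in general position. In particular, $$\alpha(\Gamma(n,T))=\alpha(\Gamma(n,S))\cdot|V\Gamma(\min S,T\setminus S)|.$$
   Context: $[n]=\{1,\dots,n\}$. For a non-empty finite set $M$, a flag of $M$ is a set $f$ of non-empty proper subsets of $M$, any two comparable under inclusion; its type is $\{|X|:X\in f\}$. Subsets $X,Y$ of $M$ are in general position if $X\cup Y=M$ or $X\cap Y=\emptyset$; flags $f,f'$ are in general position if all $X\in f$, $X'\in f'$ are. $\Gamma(m,T)$ is the graph on the flags of $[m]$ of type $T$ with adjacency = general position; $V\Gamma$ is the vertex set, and $\alpha(\Gamma)$ the independence number. For $S\subseteq T$, $\mathrm{proj}^n_{T,S}$ maps a flag $f$ of $[n]$ of type $T$ to $\{A\in f:|A|\in S\}$. -}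

module Defs where

open import Data.Nat using (ℕ; zero; suc; _≤_; _<_; _⊓_; _⊔_; _≟_)
open import Data.Fin.Subset using (Subset; _⊂_; _∪_; _∩_; ⊤; ⊥; Nonempty; ∣_∣)
open import Data.List using (List; []; _∷_; map; filter; foldr; length)
open import Data.List.Relation.Unary.All using (All)
open import Data.List.Relation.Unary.Linked using (Linked)
open import Data.List.Relation.Unary.AllPairs using (AllPairs)
open import Data.List.Relation.Unary.Unique.Propositional using (Unique)
open import Data.List.Membership.Propositional using (_∈_)
open import Data.List.Membership.DecPropositional _≟_ using (_∈?_)
open import Data.Product using (_×_; Σ; ∃)
open import Data.Sum using (_⊎_)
open import Relation.Nullary using (¬_; ¬?)
open import Relation.Binary.PropositionalEquality using (_≡_)

-- A finite set of natural numbers (a "type", e.g. S, T ⊆ [n-1]) is represented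
-- canonically by the strictly increasing list of its elements.
IsNatSet : List ℕ → Set
IsNatSet xs = Linked _<_ xs

minL : List ℕ → ℕ
minL []       = 0
minL (x ∷ xs) = foldr _⊓_ x xs

maxL : List ℕ → ℕ
maxL []       = 0
maxL (x ∷ xs) = foldr _⊔_ x xs

_∖_ : List ℕ → List ℕ → List ℕ
T ∖ S = filter (λ x → ¬? (x ∈? S)) T

_⊆ℕ_ : List ℕ → List ℕ → Set
S ⊆ℕ T = All (λ x → x ∈ T) S

-- A flag of [m] is a set of non-empty proper subsets of [m], pairwise
-- comparable; it is represented canonically as the list of its members
-- listed in strictly increasing order w.r.t. inclusion.
IsFlag : (m : ℕ) → List (Subset m) → Set
IsFlag m f = Linked _⊂_ f × All (λ X → Nonempty X × ¬ (X ≡ ⊤)) f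

-- type of a flag: the set of cardinalities of its members (strictly
-- increasing, since the chain is strictly increasing)
flagType : {m : ℕ} → List (Subset m) → List ℕ
flagType f = map ∣_∣ f

IsFlagOfType : (m : ℕ) → List ℕ → List (Subset m) → Set
IsFlagOfType m T f = IsFlag m f × flagType f ≡ T

GenPosSet : {m : ℕ} → Subset m → Subset m → Set
GenPosSet X Y = (X ∪ Y ≡ ⊤) ⊎ (X ∩ Y ≡ ⊥)

GenPos : {m : ℕ} → List (Subset m) → List (Subset m) → Set
GenPos f g = All (λ X → All (λ Y → GenPosSet X Y) g) f

proj : {n : ℕ} → List ℕ → List (Subset n) → List (Subset n)
proj S f = filter (λ A → ∣ A ∣ ∈? S) f

-- independent sets of Γ(m,T): finite sets of vertices (lists without
-- repetition) pairwise non-adjacent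
IsIndep : (m : ℕ) → List ℕ → List (List (Subset m)) → Set
IsIndep m T I = Unique I × All (IsFlagOfType m T) I × AllPairs (λ f g → ¬ GenPos f g) I

IsAlpha : (m : ℕ) → List ℕ → ℕ → Set
IsAlpha m T a =
  (Σ (List (List (Subset m))) λ I → IsIndep m T I × length I ≡ a) ×
  ((I : List (List (Subset m))) → IsIndep m T I → length I ≤ a)

IsNumVertices : (m : ℕ) → List ℕ → ℕ → Set
IsNumVertices m T c =
  Σ (List (List (Subset m))) λ L →
    Unique L ×
    ((f : List (Subset m)) → (f ∈ L → IsFlagOfType m T f) × (IsFlagOfType m T f → f ∈ L)) ×
    length L ≡ c

-- Let s = min S and U = T ∖ S.  Every size in U is below s, so a flag f of type T is
-- f = l ++ proj f, where l has type U and lies inside the first member A of proj f, which has size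
-- s.  Thus the flags of type T above a flag A ∷ p of type S are the flags of [∣ A ∣] of type U,
-- transported into A.  Every member of f lies in a member of proj f, namely A when it is not itself
-- in proj f.  Since s + max S ≤ n, members of proj f and proj g one of which has size s are
-- disjoint as soon as they are in general position; hence f and g are in general position iff
-- proj f and proj g are.  So Γ(n, T) is Γ(n, S) with each vertex replaced by an independent set of
-- |VΓ(s, U)| vertices (no flag is in general position with itself), which multiplies the
-- independence number by |VΓ(s, U)|.

module Submission where

open import Defs
open import Data.Nat using (ℕ; zero; suc; _≤_; _<_; _+_; _*_; _∸_; _⊓_; _⊔_; z≤n; s≤s)
import Data.Nat as ℕ
open import Data.Nat.Properties
  using (≤-refl; ≤-trans; ≤-antisym; <-irrefl; <-trans; <⇒≤; <-≤-trans; ≤-<-trans;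
         +-suc; +-monoʳ-≤; +-comm; +-identityʳ;
         +-cancelˡ-≤; n≤0⇒n≡0; *-monoˡ-≤; m⊓n≤n; ⊓-glb; m≤m⊔n; m≤n⊔m; module ≤-Reasoning)
import Data.Bool as Bool
open import Data.Vec using ([]; _∷_; here; there)
import Data.Vec.Properties as Vec
open import Data.Fin using (zero; suc)
open import Data.Fin.Subset
  using (Subset; inside; outside; _⊆_; _⊂_; _∪_; _∩_; ⊤; ⊥; ∣_∣; Nonempty) renaming (_∈_ to _∈ˢ_)
open import Data.Fin.Subset.Properties
  using (drop-∷-⊆; out⊆; in⊆in; in⊂in; out⊂in; out⊂; ⊆-refl; ⊆-antisym; ⊆-max; ⊥⊆; ∉⊥;
         ⊂-trans; p⊂q⇒p⊆q; p⊂q⇒∣p∣<∣q∣; ∣⊤∣≡n; x∈p∩q⁺; x∈p∩q⁻; ∪-idem; ∩-idem; ∪-comm; ∩-comm;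
         _⊂?_; nonempty?)
open import Data.List using (List; []; _∷_; [_]; _++_; length; filter; map; concatMap; deduplicate)
import Data.List.Properties as List
open import Data.List.Properties
  using (length-++; length-map; filter-notAll; filter-++; filter-all; filter-none;
         map-++; map-∘; map-cong-local; map-injective; ++-cancelʳ; ∷-injectiveˡ; ∷-injectiveʳ;
         foldr-preservesʳ; foldr-preservesᵇ; foldr-preservesᵒ)
open import Data.List.Extrema.Nat using (argmax; argmax-all; f[xs]≤f[argmax])
open import Data.List.Relation.Unary.All as All using (All; []; _∷_; all?)
import Data.List.Relation.Unary.All.Properties as All
open import Data.List.Relation.Unary.Any using (Any; here; there)
open import Data.List.Relation.Unary.AllPairs as AllPairs using (AllPairs; []; _∷_; allPairs?)
import Data.List.Relation.Unary.AllPairs.Properties as AllPairs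
open import Data.List.Relation.Unary.Linked as Linked using (Linked; []; [-]; _∷_; linked?)
import Data.List.Relation.Unary.Linked.Properties as Linked
open import Data.List.Relation.Unary.Unique.Propositional using (Unique)
import Data.List.Relation.Unary.Unique.Propositional.Properties as Unique
import Data.List.Relation.Unary.Unique.DecPropositional as UniqueDec
import Data.List.Relation.Unary.Unique.DecPropositional.Properties as UniqueDec
open import Data.List.Relation.Binary.Disjoint.Propositional using (Disjoint)
open import Data.List.Membership.Propositional using (_∈_; _∉_; lose; find)
open import Data.List.Membership.Propositional.Properties
  using (∈-filter⁺; ∈-filter⁻; ∈-++⁺ˡ; ∈-++⁺ʳ; ∈-++⁻; ∈-map⁺; ∈-map⁻; ∈-concatMap⁺; ∈-concatMap⁻;
         ∈-deduplicate⁺; ∈-deduplicate⁻)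
import Data.List.Membership.DecPropositional as DecMembership
open import Data.List.Membership.DecPropositional ℕ._≟_ using (_∈?_)
open import Data.Product using (_×_; _,_; Σ; ∃; ∃₂; proj₁; proj₂)
import Data.Product as Product
open import Data.Sum using (_⊎_; inj₁; inj₂)
open import Data.Empty using (⊥-elim)
open import Function using (_∘_; id)
open import Function.Bundles using (_⇔_; mk⇔; Equivalence)
open import Function.Related.TypeIsomorphisms using (¬-cong-⇔)
open import Relation.Nullary using (¬_; ¬?; yes; no; Dec)
open import Relation.Nullary.Decidable using (_×-dec_; _⊎-dec_)
open import Relation.Unary using (Decidable)
open import Relation.Binary.Definitions using (DecidableEquality; Symmetric) renaming (Decidable to Decidable₂)
open import Relation.Binary.PropositionalEquality
  using (_≡_; _≢_; refl; sym; trans; cong; cong₂; subst; subst₂; module ≡-Reasoning)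

private
  variable
    A B : Set
    m : ℕ

-- Lists

module _ (_≟_ : DecidableEquality A) where

  Unique-⊆⇒length≤ : {xs ys : List A} → Unique xs → (∀ {x} → x ∈ xs → x ∈ ys) → length xs ≤ length ys
  Unique-⊆⇒length≤ {[]} _ _ = z≤n
  Unique-⊆⇒length≤ {x ∷ xs} {ys} (x∉xs ∷ u) x∷xs⊆ys =
    ≤-trans (s≤s (Unique-⊆⇒length≤ u xs⊆ys-x))
            (filter-notAll ≢x? ys (lose (x∷xs⊆ys (here refl)) λ x≢x → x≢x refl))
    where
    ≢x? : Decidable (_≢ x)
    ≢x? y = ¬? (y ≟ x)
    xs⊆ys-x : ∀ {y} → y ∈ xs → y ∈ filter ≢x? ys
    xs⊆ys-x y∈xs = ∈-filter⁺ ≢x? (x∷xs⊆ys (there y∈xs)) (λ y≡x → All.lookup x∉xs y∈xs (sym y≡x))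

AllPairs-lookup : ∀ {R : A → A → Set} {xs x y} → AllPairs R xs → x ∈ xs → y ∈ xs → x ≢ y → R x y ⊎ R y x
AllPairs-lookup (_ ∷ _) (here refl) (here refl) x≢y = ⊥-elim (x≢y refl)
AllPairs-lookup (Rx ∷ _) (here refl) (there y∈) _ = inj₁ (All.lookup Rx y∈)
AllPairs-lookup (Ry ∷ _) (there x∈) (here refl) _ = inj₂ (All.lookup Ry x∈)
AllPairs-lookup (_ ∷ pairs) (there x∈) (there y∈) x≢y = AllPairs-lookup pairs x∈ y∈ x≢y

AllPairs-tabulate : ∀ {R : A → A → Set} {xs} → Unique xs →
  (∀ {x y} → x ∈ xs → y ∈ xs → x ≢ y → R x y) → AllPairs R xs
AllPairs-tabulate [] _ = []
AllPairs-tabulate (x∉xs ∷ u) R-distinct =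
  All.tabulate (λ y∈ → R-distinct (here refl) (there y∈) (All.lookup x∉xs y∈)) ∷
  AllPairs-tabulate u (λ x∈ y∈ → R-distinct (there x∈) (there y∈))

length-concatMap : ∀ (f : A → List B) {c xs} → All (λ x → length (f x) ≡ c) xs →
  length (concatMap f xs) ≡ length xs * c
length-concatMap f [] = refl
length-concatMap f {xs = x ∷ _} (|fx|≡c ∷ rest) =
  trans (length-++ (f x)) (cong₂ _+_ |fx|≡c (length-concatMap f rest))

Unique-concatMap : ∀ (h : B → A) (f : A → List B) {xs} → Unique xs →
  All (λ x → Unique (f x) × All (λ y → h y ≡ x) (f x)) xs → Unique (concatMap f xs)
Unique-concatMap h f [] [] = []
Unique-concatMap h f {x ∷ xs} (x∉xs ∷ u) ((ufx , h≡x) ∷ rest) =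
  Unique.++⁺ ufx (Unique-concatMap h f u rest) disjoint
  where
  disjoint : Disjoint (f x) (concatMap f xs)
  disjoint (y∈fx , y∈rest) with find (∈-concatMap⁻ f {xs = xs} y∈rest)
  ... | x′ , x′∈xs , y∈fx′ =
    All.lookup x∉xs x′∈xs (trans (sym (All.lookup h≡x y∈fx)) (All.lookup (proj₂ (All.lookup rest x′∈xs)) y∈fx′))

sublists : List A → List (List A)
sublists [] = [ [] ]
sublists (x ∷ xs) = map (x ∷_) (sublists xs) ++ sublists xs

filter∈sublists : ∀ {P : A → Set} (P? : Decidable P) xs → filter P? xs ∈ sublists xs
filter∈sublists P? [] = here refl
filter∈sublists P? (x ∷ xs) with P? x
... | yes _ = ∈-++⁺ˡ (∈-map⁺ (x ∷_) (filter∈sublists P? xs))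
... | no _ = ∈-++⁺ʳ (map (x ∷_) (sublists xs)) (filter∈sublists P? xs)

listsOver : List A → ℕ → List (List A)
listsOver xs zero = [ [] ]
listsOver xs (suc k) = concatMap (λ x → map (x ∷_) (listsOver xs k)) xs

∈-listsOver : ∀ {xs ys : List A} → All (_∈ xs) ys → ys ∈ listsOver xs (length ys)
∈-listsOver [] = here refl
∈-listsOver {xs = xs} {y ∷ ys} (y∈xs ∷ ys⊆xs) =
  ∈-concatMap⁺ (λ x → map (x ∷_) (listsOver xs (length ys))) (lose y∈xs (∈-map⁺ (y ∷_) (∈-listsOver ys⊆xs)))

map-≡-++ : ∀ (g : A → B) {xs} ys {zs} → map g xs ≡ ys ++ zs →
  ∃₂ λ xs₁ xs₂ → xs ≡ xs₁ ++ xs₂ × map g xs₁ ≡ ys × map g xs₂ ≡ zs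
map-≡-++ g [] eq = [] , _ , refl , refl , eq
map-≡-++ g {x ∷ xs} (y ∷ ys) eq with map-≡-++ g ys (∷-injectiveʳ eq)
... | xs₁ , xs₂ , refl , eq₁ , eq₂ = x ∷ xs₁ , xs₂ , refl , cong₂ _∷_ (∷-injectiveˡ eq) eq₁ , eq₂

Linked-++⁻ˡ : ∀ {R : A → A → Set} xs {ys} → Linked R (xs ++ ys) → Linked R xs
Linked-++⁻ˡ [] _ = []
Linked-++⁻ˡ (x ∷ []) _ = [-]
Linked-++⁻ˡ (x ∷ y ∷ xs) (Rxy ∷ linked) = Rxy ∷ Linked-++⁻ˡ (y ∷ xs) linked

∈-map-≡ : ∀ {g : A → B} {xs ys x} → map g xs ≡ ys → x ∈ xs → g x ∈ ys
∈-map-≡ refl x∈xs = ∈-map⁺ _ x∈xs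

Linked<-head : ∀ {x xs} → Linked _<_ (x ∷ xs) → All (x <_) xs
Linked<-head linked with Linked.Linked⇒AllPairs <-trans linked
... | x<xs ∷ _ = x<xs

Linked<-least : ∀ {x xs z} → Linked _<_ (x ∷ xs) → z ∈ x ∷ xs → x ≤ z
Linked<-least _ (here refl) = ≤-refl
Linked<-least linked (there z∈xs) = <⇒≤ (All.lookup (Linked<-head linked) z∈xs)

Linked<-≡ : ∀ {xs ys} → Linked _<_ xs → Linked _<_ ys →
  (∀ {z} → z ∈ xs → z ∈ ys) → (∀ {z} → z ∈ ys → z ∈ xs) → xs ≡ ys
Linked<-≡ {[]} {[]} _ _ _ _ = refl
Linked<-≡ {[]} {y ∷ _} _ _ _ ys⊆xs with ys⊆xs (here refl)
... | ()
Linked<-≡ {x ∷ _} {[]} _ _ xs⊆ys _ with xs⊆ys (here refl)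
... | ()
Linked<-≡ {x ∷ xs} {y ∷ ys} lx ly xs⊆ys ys⊆xs
  with ≤-antisym (Linked<-least lx (ys⊆xs (here refl))) (Linked<-least ly (xs⊆ys (here refl)))
... | refl = cong (x ∷_) (Linked<-≡ (Linked.tail lx) (Linked.tail ly) (tail-⊆ lx xs⊆ys) (tail-⊆ ly ys⊆xs))
  where
  tail-⊆ : ∀ {us vs} → Linked _<_ (x ∷ us) → (∀ {z} → z ∈ x ∷ us → z ∈ x ∷ vs) → ∀ {z} → z ∈ us → z ∈ vs
  tail-⊆ linked sub z∈us with sub (there z∈us)
  ... | here refl = ⊥-elim (<-irrefl refl (All.lookup (Linked<-head linked) z∈us))
  ... | there z∈vs = z∈vs

minL-Linked< : ∀ {x xs} → Linked _<_ (x ∷ xs) → minL (x ∷ xs) ≡ x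
minL-Linked< {x} {xs} linked = ≤-antisym
  (foldr-preservesʳ {P = _≤ x} (λ y z≤x → ≤-trans (m⊓n≤n y _) z≤x) ≤-refl xs)
  (foldr-preservesᵇ {P = x ≤_} ⊓-glb ≤-refl (All.map <⇒≤ (Linked<-head linked)))

≤maxL : ∀ {xs x} → x ∈ xs → x ≤ maxL xs
≤maxL {y ∷ ys} {x} x∈ = foldr-preservesᵒ {P = x ≤_} ≤⊔ y ys (start x∈)
  where
  ≤⊔ : ∀ a b → x ≤ a ⊎ x ≤ b → x ≤ a ⊔ b
  ≤⊔ a b (inj₁ x≤a) = ≤-trans x≤a (m≤m⊔n a b)
  ≤⊔ a b (inj₂ x≤b) = ≤-trans x≤b (m≤n⊔m a b)
  start : x ∈ y ∷ ys → x ≤ y ⊎ Any (x ≤_) ys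
  start (here refl) = inj₁ ≤-refl
  start (there x∈ys) = inj₂ (lose x∈ys ≤-refl)

Linked<-∖-++ : ∀ {S T} → Linked _<_ S → Linked _<_ T → S ⊆ℕ T →
  (∀ {u x} → u ∈ T ∖ S → x ∈ S → u < x) → T ≡ (T ∖ S) ++ S
Linked<-∖-++ {S} {T} sortedS sortedT S⊆T U<S =
  Linked<-≡ sortedT sorted T⊆U++S U++S⊆T
  where
  ∉S? : Decidable (_∉ S)
  ∉S? x = ¬? (x ∈? S)
  sorted : Linked _<_ ((T ∖ S) ++ S)
  sorted = Linked.AllPairs⇒Linked (AllPairs.++⁺
    (Linked.Linked⇒AllPairs <-trans (Linked.filter⁺ ∉S? <-trans sortedT))
    (Linked.Linked⇒AllPairs <-trans sortedS)
    (All.tabulate (λ u∈ → All.tabulate (U<S u∈))))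
  T⊆U++S : ∀ {x} → x ∈ T → x ∈ (T ∖ S) ++ S
  T⊆U++S {x} x∈T with x ∈? S
  ... | yes x∈S = ∈-++⁺ʳ (T ∖ S) x∈S
  ... | no x∉S = ∈-++⁺ˡ (∈-filter⁺ ∉S? x∈T x∉S)
  U++S⊆T : ∀ {x} → x ∈ (T ∖ S) ++ S → x ∈ T
  U++S⊆T x∈ with ∈-++⁻ (T ∖ S) x∈
  ... | inj₁ x∈U = proj₁ (∈-filter⁻ ∉S? x∈U)
  ... | inj₂ x∈S = All.lookup S⊆T x∈S

-- Independent sets of a graph given by its vertices and its non-adjacency relation _≁_

module IndependentSets {V : Set} (Vertex : V → Set) (_≁_ : V → V → Set) where

  Independent : List V → Set
  Independent I = Unique I × All Vertex I × AllPairs _≁_ I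

  IsIndependenceNumber : ℕ → Set
  IsIndependenceNumber a =
    (Σ (List V) λ I → Independent I × length I ≡ a) × ((I : List V) → Independent I → length I ≤ a)

  module _ (_≟_ : DecidableEquality V) (≁-sym : Symmetric _≁_) where

    Independent-≁ : (∀ {v} → Vertex v → v ≁ v) →
      ∀ {I v w} → Independent I → v ∈ I → w ∈ I → v ≁ w
    Independent-≁ ≁-refl {v = v} {w} (_ , vertices , pairs) v∈ w∈ with v ≟ w
    ... | yes refl = ≁-refl (All.lookup vertices v∈)
    ... | no v≢w with AllPairs-lookup pairs v∈ w∈ v≢w
    ...   | inj₁ v≁w = v≁w
    ...   | inj₂ w≁v = ≁-sym w≁v

    independenceNumber : Decidable Vertex → Decidable₂ _≁_ →
      (L : List V) → Unique L → (∀ {v} → Vertex v → v ∈ L) → Σ ℕ IsIndependenceNumber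
    independenceNumber vertex? _≁?_ L unique complete = length J , (J , J-independent , refl) , bound
      where
      open DecMembership _≟_ using () renaming (_∈?_ to _∈ⱽ?_)
      independent? : Decidable Independent
      independent? I = UniqueDec.unique? _≟_ I ×-dec all? vertex? I ×-dec allPairs? _≁?_ I
      candidates : List (List V)
      candidates = filter independent? (sublists L)
      J : List V
      J = argmax length [] candidates
      J-independent : Independent J
      J-independent = argmax-all length ([] , [] , []) (All.all-filter independent? (sublists L))
      bound : (I : List V) → Independent I → length I ≤ length J
      bound I I-independent@(uI , vertices , pairs) =
        ≤-trans (Unique-⊆⇒length≤ _≟_ uI I⊆I′)
                (All.lookup (f[xs]≤f[argmax] {f = length} [] candidates) I′∈candidates)
        where
        I′ : List V
        I′ = filter (_∈ⱽ? I) L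
        I′⊆I : ∀ {v} → v ∈ I′ → v ∈ I
        I′⊆I v∈ = proj₂ (∈-filter⁻ (_∈ⱽ? I) {xs = L} v∈)
        I⊆I′ : ∀ {v} → v ∈ I → v ∈ I′
        I⊆I′ v∈ = ∈-filter⁺ (_∈ⱽ? I) (complete (All.lookup vertices v∈)) v∈
        uI′ : Unique I′
        uI′ = Unique.filter⁺ (_∈ⱽ? I) unique
        I′∈candidates : I′ ∈ candidates
        I′∈candidates = ∈-filter⁺ independent? (filter∈sublists (_∈ⱽ? I) L)
          (uI′ , All.tabulate (All.lookup vertices ∘ I′⊆I) ,
           AllPairs-tabulate uI′ λ v∈ w∈ v≢w → ≁-of (AllPairs-lookup pairs (I′⊆I v∈) (I′⊆I w∈) v≢w))
          where
          ≁-of : ∀ {v w} → v ≁ w ⊎ w ≁ v → v ≁ w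
          ≁-of (inj₁ v≁w) = v≁w
          ≁-of (inj₂ w≁v) = ≁-sym w≁v

-- Replacing every vertex p of W by the independent set  fiber p  of c vertices multiplies
-- the independence number by c.
module _ {V W : Set} {VertexV : V → Set} {_≁V_ : V → V → Set} {VertexW : W → Set} {_≁W_ : W → W → Set}
  (_≟V_ : DecidableEquality V) (_≟W_ : DecidableEquality W)
  (≁W-sym : Symmetric _≁W_) (≁W-refl : ∀ {p} → VertexW p → p ≁W p)
  (h : V → W) (h-vertex : ∀ {f} → VertexV f → VertexW (h f))
  (h-≁ : ∀ {f g} → VertexV f → VertexV g → f ≁V g ⇔ h f ≁W h g)
  (fiber : W → List V) (c : ℕ)
  (fiber-length : ∀ {p} → VertexW p → length (fiber p) ≡ c)
  (fiber-unique : ∀ p → Unique (fiber p))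
  (fiber-sound : ∀ {p f} → VertexW p → f ∈ fiber p → VertexV f × h f ≡ p)
  (fiber-complete : ∀ {f} → VertexV f → f ∈ fiber (h f)) where

  private
    module G = IndependentSets VertexV _≁V_
    module H = IndependentSets VertexW _≁W_

  length-concatMap-fiber : ∀ {I} → All VertexW I → length (concatMap fiber I) ≡ length I * c
  length-concatMap-fiber vertices = length-concatMap fiber (All.map fiber-length vertices)

  concatMap-fiber-independent : ∀ {I} → H.Independent I → G.Independent (concatMap fiber I)
  concatMap-fiber-independent {I} I-independent@(uI , vertices , _) =
    unique , All.tabulate (proj₁ ∘ sound) ,
    AllPairs-tabulate unique λ f∈ g∈ _ →
      Equivalence.from (h-≁ (proj₁ (sound f∈)) (proj₁ (sound g∈)))
        (H.Independent-≁ _≟W_ ≁W-sym ≁W-refl I-independent (proj₂ (sound f∈)) (proj₂ (sound g∈)))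
    where
    sound : ∀ {f} → f ∈ concatMap fiber I → VertexV f × h f ∈ I
    sound f∈ with find (∈-concatMap⁻ fiber {xs = I} f∈)
    ... | p , p∈I , f∈fiber with fiber-sound (All.lookup vertices p∈I) f∈fiber
    ...   | vf , refl = vf , p∈I
    unique : Unique (concatMap fiber I)
    unique = Unique-concatMap h fiber uI
      (All.tabulate λ p∈ → fiber-unique _ , All.tabulate (proj₂ ∘ fiber-sound (All.lookup vertices p∈)))

  image : List V → List W
  image J = deduplicate _≟W_ (map h J)

  image-independent : ∀ {J} → G.Independent J → H.Independent (image J)
  image-independent {J} (_ , vertices , pairs) =
    unique , All.tabulate (vertex ∘ ∈image⁻) , AllPairs-tabulate unique λ p∈ q∈ → ≁ (∈image⁻ p∈) (∈image⁻ q∈)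
    where
    ∈image⁻ : ∀ {p} → p ∈ image J → ∃ λ f → f ∈ J × p ≡ h f
    ∈image⁻ p∈ = ∈-map⁻ h (∈-deduplicate⁻ _≟W_ (map h J) p∈)
    unique : Unique (image J)
    unique = UniqueDec.deduplicate-! _≟W_ (map h J)
    vertex : ∀ {p} → ∃ (λ f → f ∈ J × p ≡ h f) → VertexW p
    vertex (f , f∈ , refl) = h-vertex (All.lookup vertices f∈)
    ≁ : ∀ {p q} → ∃ (λ f → f ∈ J × p ≡ h f) → ∃ (λ g → g ∈ J × q ≡ h g) → p ≢ q → p ≁W q
    ≁ (f , f∈ , refl) (g , g∈ , refl) hf≢hg with AllPairs-lookup pairs f∈ g∈ (hf≢hg ∘ cong h)
    ... | inj₁ f≁g = Equivalence.to (h-≁ (All.lookup vertices f∈) (All.lookup vertices g∈)) f≁g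
    ... | inj₂ g≁f = ≁W-sym (Equivalence.to (h-≁ (All.lookup vertices g∈) (All.lookup vertices f∈)) g≁f)

  ⊆concatMap-fiber-image : ∀ {J f} → All VertexV J → f ∈ J → f ∈ concatMap fiber (image J)
  ⊆concatMap-fiber-image vertices f∈ =
    ∈-concatMap⁺ fiber (lose (∈-deduplicate⁺ _≟W_ (∈-map⁺ h f∈)) (fiber-complete (All.lookup vertices f∈)))

  independenceNumber-blowUp : ∀ {a} → H.IsIndependenceNumber a → G.IsIndependenceNumber (a * c)
  independenceNumber-blowUp {a} ((I , I-independent@(_ , I-vertices , _) , |I|≡a) , maximal) =
    (concatMap fiber I , concatMap-fiber-independent I-independent ,
     trans (length-concatMap-fiber I-vertices) (cong (_* c) |I|≡a)) ,
    bound
    where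
    bound : (J : List V) → G.Independent J → length J ≤ a * c
    bound J J-independent@(uJ , J-vertices , _) = begin
      length J                            ≤⟨ Unique-⊆⇒length≤ _≟V_ uJ (⊆concatMap-fiber-image J-vertices) ⟩
      length (concatMap fiber (image J))  ≡⟨ length-concatMap-fiber (proj₁ (proj₂ image-J-independent)) ⟩
      length (image J) * c                ≤⟨ *-monoˡ-≤ c (maximal (image J) image-J-independent) ⟩
      a * c                               ∎
      where
      open ≤-Reasoning
      image-J-independent : H.Independent (image J)
      image-J-independent = image-independent J-independent

-- Subsets of [n]

∣p∪q∣+∣p∩q∣≡∣p∣+∣q∣ : ∀ {n} (p q : Subset n) → ∣ p ∪ q ∣ + ∣ p ∩ q ∣ ≡ ∣ p ∣ + ∣ q ∣
∣p∪q∣+∣p∩q∣≡∣p∣+∣q∣ [] [] = refl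
∣p∪q∣+∣p∩q∣≡∣p∣+∣q∣ (inside ∷ p) (inside ∷ q) =
  cong suc (trans (+-suc _ _) (trans (cong suc (∣p∪q∣+∣p∩q∣≡∣p∣+∣q∣ p q)) (sym (+-suc _ _))))
∣p∪q∣+∣p∩q∣≡∣p∣+∣q∣ (inside ∷ p) (outside ∷ q) = cong suc (∣p∪q∣+∣p∩q∣≡∣p∣+∣q∣ p q)
∣p∪q∣+∣p∩q∣≡∣p∣+∣q∣ (outside ∷ p) (inside ∷ q) =
  trans (cong suc (∣p∪q∣+∣p∩q∣≡∣p∣+∣q∣ p q)) (sym (+-suc _ _))
∣p∪q∣+∣p∩q∣≡∣p∣+∣q∣ (outside ∷ p) (outside ∷ q) = ∣p∪q∣+∣p∩q∣≡∣p∣+∣q∣ p q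

∣p∣≡0⇒p≡⊥ : ∀ {n} (p : Subset n) → ∣ p ∣ ≡ 0 → p ≡ ⊥
∣p∣≡0⇒p≡⊥ [] _ = refl
∣p∣≡0⇒p≡⊥ (outside ∷ p) ∣p∣≡0 = cong (outside ∷_) (∣p∣≡0⇒p≡⊥ p ∣p∣≡0)

Nonempty⇒∣p∣>0 : ∀ {n} {p : Subset n} → Nonempty p → 0 < ∣ p ∣
Nonempty⇒∣p∣>0 {p = inside ∷ p} _ = s≤s z≤n
Nonempty⇒∣p∣>0 {p = outside ∷ p} (suc x , there x∈p) = Nonempty⇒∣p∣>0 (x , x∈p)

∣p∣>0⇒Nonempty : ∀ {n} {p : Subset n} → 0 < ∣ p ∣ → Nonempty p
∣p∣>0⇒Nonempty {p = inside ∷ p} _ = zero , here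
∣p∣>0⇒Nonempty {p = outside ∷ p} ∣p∣>0 = Product.map suc there (∣p∣>0⇒Nonempty ∣p∣>0)

∣p∣<n⇒p≢⊤ : ∀ {n} {p : Subset n} → ∣ p ∣ < n → p ≢ ⊤
∣p∣<n⇒p≢⊤ {n} ∣p∣<n refl = <-irrefl (∣⊤∣≡n n) ∣p∣<n

p⊆q∧∣p∣<∣q∣⇒p⊂q : ∀ {n} {p q : Subset n} → p ⊆ q → ∣ p ∣ < ∣ q ∣ → p ⊂ q
p⊆q∧∣p∣<∣q∣⇒p⊂q {p = inside ∷ p} {inside ∷ q} p⊆q (s≤s ∣p∣<∣q∣) = in⊂in (p⊆q∧∣p∣<∣q∣⇒p⊂q (drop-∷-⊆ p⊆q) ∣p∣<∣q∣)
p⊆q∧∣p∣<∣q∣⇒p⊂q {p = inside ∷ p} {outside ∷ q} p⊆q _ with p⊆q here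
... | ()
p⊆q∧∣p∣<∣q∣⇒p⊂q {p = outside ∷ p} {inside ∷ q} p⊆q _ = out⊂in (drop-∷-⊆ p⊆q)
p⊆q∧∣p∣<∣q∣⇒p⊂q {p = outside ∷ p} {outside ∷ q} p⊆q ∣p∣<∣q∣ = out⊂ (p⊆q∧∣p∣<∣q∣⇒p⊂q (drop-∷-⊆ p⊆q) ∣p∣<∣q∣)

⊆-∩-≡⊥ : ∀ {n} {p p′ q q′ : Subset n} → p ⊆ p′ → q ⊆ q′ → p′ ∩ q′ ≡ ⊥ → p ∩ q ≡ ⊥
⊆-∩-≡⊥ {p = p} {q = q} p⊆p′ q⊆q′ p′∩q′≡⊥ = ⊆-antisym p∩q⊆⊥ ⊥⊆
  where
  p∩q⊆⊥ : p ∩ q ⊆ ⊥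
  p∩q⊆⊥ x∈p∩q = subst (_ ∈ˢ_) p′∩q′≡⊥ (x∈p∩q⁺ (Product.map p⊆p′ q⊆q′ (x∈p∩q⁻ p q x∈p∩q)))

GenPosSet-sym : ∀ {n} {X Y : Subset n} → GenPosSet X Y → GenPosSet Y X
GenPosSet-sym {X = X} {Y} (inj₁ X∪Y≡⊤) = inj₁ (trans (∪-comm Y X) X∪Y≡⊤)
GenPosSet-sym {X = X} {Y} (inj₂ X∩Y≡⊥) = inj₂ (trans (∩-comm Y X) X∩Y≡⊥)

-- Here  X ∪ Y = ⊤  forces  ∣ X ∩ Y ∣ = ∣ X ∣ + ∣ Y ∣ - n = 0.
GenPosSet⇒disjoint : ∀ {n} {X Y : Subset n} → GenPosSet X Y → ∣ X ∣ + ∣ Y ∣ ≤ n → X ∩ Y ≡ ⊥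
GenPosSet⇒disjoint (inj₂ X∩Y≡⊥) _ = X∩Y≡⊥
GenPosSet⇒disjoint {n} {X} {Y} (inj₁ X∪Y≡⊤) ∣X∣+∣Y∣≤n =
  ∣p∣≡0⇒p≡⊥ (X ∩ Y) (n≤0⇒n≡0 (+-cancelˡ-≤ n _ _ n+∣X∩Y∣≤n+0))
  where
  open ≤-Reasoning
  n+∣X∩Y∣≤n+0 : n + ∣ X ∩ Y ∣ ≤ n + 0
  n+∣X∩Y∣≤n+0 = begin
    n + ∣ X ∩ Y ∣         ≡⟨ cong (_+ ∣ X ∩ Y ∣) (trans (cong ∣_∣ X∪Y≡⊤) (∣⊤∣≡n n)) ⟨
    ∣ X ∪ Y ∣ + ∣ X ∩ Y ∣ ≡⟨ ∣p∪q∣+∣p∩q∣≡∣p∣+∣q∣ X Y ⟩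
    ∣ X ∣ + ∣ Y ∣         ≤⟨ ∣X∣+∣Y∣≤n ⟩
    n                     ≡⟨ +-identityʳ n ⟨
    n + 0                 ∎

-- expand A identifies subsets of [∣ A ∣] with subsets of A, order-preservingly.
expand : ∀ {n} (A : Subset n) → Subset ∣ A ∣ → Subset n
expand [] Y = []
expand (inside ∷ A) (y ∷ Y) = y ∷ expand A Y
expand (outside ∷ A) Y = outside ∷ expand A Y

compress : ∀ {n} (A : Subset n) → Subset n → Subset ∣ A ∣
compress [] [] = []
compress (inside ∷ A) (x ∷ X) = x ∷ compress A X
compress (outside ∷ A) (x ∷ X) = compress A X

expand-⊆ : ∀ {n} (A : Subset n) Y → expand A Y ⊆ A
expand-⊆ [] Y = id
expand-⊆ (inside ∷ A) (inside ∷ Y) = in⊆in (expand-⊆ A Y)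
expand-⊆ (inside ∷ A) (outside ∷ Y) = out⊆ (expand-⊆ A Y)
expand-⊆ (outside ∷ A) Y = out⊆ (expand-⊆ A Y)

∣expand∣ : ∀ {n} (A : Subset n) Y → ∣ expand A Y ∣ ≡ ∣ Y ∣
∣expand∣ [] [] = refl
∣expand∣ (inside ∷ A) (inside ∷ Y) = cong suc (∣expand∣ A Y)
∣expand∣ (inside ∷ A) (outside ∷ Y) = ∣expand∣ A Y
∣expand∣ (outside ∷ A) Y = ∣expand∣ A Y

expand-⊆⁺ : ∀ {n} (A : Subset n) {Y Y′} → Y ⊆ Y′ → expand A Y ⊆ expand A Y′
expand-⊆⁺ [] _ = id
expand-⊆⁺ (inside ∷ A) {inside ∷ Y} {inside ∷ Y′} Y⊆Y′ = in⊆in (expand-⊆⁺ A (drop-∷-⊆ Y⊆Y′))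
expand-⊆⁺ (inside ∷ A) {inside ∷ Y} {outside ∷ Y′} Y⊆Y′ with Y⊆Y′ here
... | ()
expand-⊆⁺ (inside ∷ A) {outside ∷ Y} {_ ∷ Y′} Y⊆Y′ = out⊆ (expand-⊆⁺ A (drop-∷-⊆ Y⊆Y′))
expand-⊆⁺ (outside ∷ A) Y⊆Y′ = out⊆ (expand-⊆⁺ A Y⊆Y′)

expand-⊆⁻ : ∀ {n} (A : Subset n) {Y Y′} → expand A Y ⊆ expand A Y′ → Y ⊆ Y′
expand-⊆⁻ [] {[]} {[]} _ = id
expand-⊆⁻ (inside ∷ A) {inside ∷ Y} {inside ∷ Y′} sub = in⊆in (expand-⊆⁻ A (drop-∷-⊆ sub))
expand-⊆⁻ (inside ∷ A) {inside ∷ Y} {outside ∷ Y′} sub with sub here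
... | ()
expand-⊆⁻ (inside ∷ A) {outside ∷ Y} {_ ∷ Y′} sub = out⊆ (expand-⊆⁻ A (drop-∷-⊆ sub))
expand-⊆⁻ (outside ∷ A) sub = expand-⊆⁻ A (drop-∷-⊆ sub)

expand-⊂⁺ : ∀ {n} (A : Subset n) {Y Y′} → Y ⊂ Y′ → expand A Y ⊂ expand A Y′
expand-⊂⁺ A {Y} {Y′} Y⊂Y′ = p⊆q∧∣p∣<∣q∣⇒p⊂q (expand-⊆⁺ A (p⊂q⇒p⊆q Y⊂Y′))
  (subst₂ _<_ (sym (∣expand∣ A Y)) (sym (∣expand∣ A Y′)) (p⊂q⇒∣p∣<∣q∣ Y⊂Y′))

expand-⊂⁻ : ∀ {n} (A : Subset n) {Y Y′} → expand A Y ⊂ expand A Y′ → Y ⊂ Y′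
expand-⊂⁻ A {Y} {Y′} ⊂′ = p⊆q∧∣p∣<∣q∣⇒p⊂q (expand-⊆⁻ A (p⊂q⇒p⊆q ⊂′))
  (subst₂ _<_ (∣expand∣ A Y) (∣expand∣ A Y′) (p⊂q⇒∣p∣<∣q∣ ⊂′))

expand-injective : ∀ {n} (A : Subset n) {Y Y′} → expand A Y ≡ expand A Y′ → Y ≡ Y′
expand-injective A eq = ⊆-antisym (expand-⊆⁻ A (subst (_ ⊆_) eq ⊆-refl)) (expand-⊆⁻ A (subst (_⊆ _) eq ⊆-refl))

expand-compress : ∀ {n} (A X : Subset n) → X ⊆ A → expand A (compress A X) ≡ X
expand-compress [] [] _ = refl
expand-compress (inside ∷ A) (x ∷ X) X⊆A = cong (x ∷_) (expand-compress A X (drop-∷-⊆ X⊆A))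
expand-compress (outside ∷ A) (inside ∷ X) X⊆A with X⊆A here
... | ()
expand-compress (outside ∷ A) (outside ∷ X) X⊆A = cong (outside ∷_) (expand-compress A X (drop-∷-⊆ X⊆A))

-- Flags

_≟ˢ_ : DecidableEquality (Subset m)
_≟ˢ_ = Vec.≡-dec Bool._≟_

_≟ᶠ_ : DecidableEquality (List (Subset m))
_≟ᶠ_ = List.≡-dec _≟ˢ_

GenPos-sym : {f g : List (Subset m)} → GenPos f g → GenPos g f
GenPos-sym gp = All.tabulate λ Y∈ → All.tabulate λ X∈ → GenPosSet-sym (All.lookup (All.lookup gp X∈) Y∈)

genPos? : (f g : List (Subset m)) → Dec (GenPos f g)
genPos? f g = all? (λ X → all? (λ Y → ((X ∪ Y) ≟ˢ ⊤) ⊎-dec ((X ∩ Y) ≟ˢ ⊥)) g) f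

isFlagOfType? : ∀ m R → Decidable (IsFlagOfType m R)
isFlagOfType? m R f =
  (linked? _⊂?_ f ×-dec all? (λ X → nonempty? X ×-dec ¬? (X ≟ˢ ⊤)) f) ×-dec List.≡-dec ℕ._≟_ (flagType f) R

¬GenPos-self : ∀ {X f} → IsFlag m (X ∷ f) → ¬ GenPos (X ∷ f) (X ∷ f)
¬GenPos-self {X = X} (_ , (nonempty , X≢⊤) ∷ _) gp with All.lookup (All.lookup gp (here refl)) (here refl)
... | inj₁ X∪X≡⊤ = X≢⊤ (trans (sym (∪-idem X)) X∪X≡⊤)
... | inj₂ X∩X≡⊥ = ∉⊥ (subst (proj₁ nonempty ∈ˢ_) (trans (sym (∩-idem X)) X∩X≡⊥) (proj₂ nonempty))

flag-⊆ : ∀ {f : List (Subset m)} {X Y} → Linked _⊂_ f → X ∈ f → Y ∈ f → ∣ X ∣ ≤ ∣ Y ∣ → X ⊆ Y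
flag-⊆ {X = X} {Y} linked X∈ Y∈ ∣X∣≤∣Y∣ with X ≟ˢ Y
... | yes refl = ⊆-refl
... | no X≢Y with AllPairs-lookup (Linked.Linked⇒AllPairs ⊂-trans linked) X∈ Y∈ X≢Y
...   | inj₁ X⊂Y = p⊂q⇒p⊆q X⊂Y
...   | inj₂ Y⊂X = ⊥-elim (<-irrefl refl (<-≤-trans (p⊂q⇒∣p∣<∣q∣ Y⊂X) ∣X∣≤∣Y∣))

allSubsets : (m : ℕ) → List (Subset m)
allSubsets zero = [ [] ]
allSubsets (suc m) = map (inside ∷_) (allSubsets m) ++ map (outside ∷_) (allSubsets m)

∈-allSubsets : (X : Subset m) → X ∈ allSubsets m
∈-allSubsets [] = here refl
∈-allSubsets (inside ∷ X) = ∈-++⁺ˡ (∈-map⁺ (inside ∷_) (∈-allSubsets X))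
∈-allSubsets {suc m} (outside ∷ X) = ∈-++⁺ʳ (map (inside ∷_) (allSubsets m)) (∈-map⁺ (outside ∷_) (∈-allSubsets X))

flagsOfType : (m : ℕ) → List ℕ → List (List (Subset m))
flagsOfType m R = deduplicate _≟ᶠ_ (filter (isFlagOfType? m R) (listsOver (allSubsets m) (length R)))

flagsOfType-unique : ∀ m R → Unique (flagsOfType m R)
flagsOfType-unique m R = UniqueDec.deduplicate-! _≟ᶠ_ _

∈-flagsOfType⁻ : ∀ {m R f} → f ∈ flagsOfType m R → IsFlagOfType m R f
∈-flagsOfType⁻ {m} {R} f∈ =
  proj₂ (∈-filter⁻ (isFlagOfType? m R) {xs = listsOver (allSubsets m) (length R)} (∈-deduplicate⁻ _≟ᶠ_ _ f∈))

∈-flagsOfType⁺ : ∀ {m R f} → IsFlagOfType m R f → f ∈ flagsOfType m R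
∈-flagsOfType⁺ {m} {R} {f} f-flag@(_ , f-type) = ∈-deduplicate⁺ _≟ᶠ_ (∈-filter⁺ (isFlagOfType? m R) f∈lists f-flag)
  where
  f∈lists : f ∈ listsOver (allSubsets m) (length R)
  f∈lists = subst (λ k → f ∈ listsOver (allSubsets m) k) (trans (sym (length-map ∣_∣ f)) (cong length f-type))
    (∈-listsOver (All.tabulate (λ {X} _ → ∈-allSubsets X)))

flagsOfType-count : ∀ m R → IsNumVertices m R (length (flagsOfType m R))
flagsOfType-count m R = flagsOfType m R , flagsOfType-unique m R , (λ f → ∈-flagsOfType⁻ , ∈-flagsOfType⁺) , refl

independenceNumber-exists : ∀ m R → Σ ℕ (IsAlpha m R)
independenceNumber-exists m R =
  IndependentSets.independenceNumber (IsFlagOfType m R) (λ f g → ¬ GenPos f g) _≟ᶠ_ (λ f≁g → f≁g ∘ GenPos-sym)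
    (isFlagOfType? m R) (λ f g → ¬? (genPos? f g)) (flagsOfType m R) (flagsOfType-unique m R) ∈-flagsOfType⁺

-- Flags of type U ++ S with U below min S

module Projection (n s : ℕ) (S′ U T : List ℕ) (T≡U++S : T ≡ U ++ s ∷ S′)
  (U<s : All (_< s) U) (s≤S′ : All (s ≤_) S′) (s+S≤n : All (λ x → s + x ≤ n) (s ∷ S′)) where

  S : List ℕ
  S = s ∷ S′

  U∉S : ∀ {x} → x ∈ U → x ∉ S
  U∉S x∈U (here refl) = <-irrefl refl (All.lookup U<s x∈U)
  U∉S x∈U (there x∈S′) = <-irrefl refl (<-≤-trans (All.lookup U<s x∈U) (All.lookup s≤S′ x∈S′))

  ∈S? : (X : Subset n) → Dec (∣ X ∣ ∈ S)
  ∈S? X = ∣ X ∣ ∈? S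

  ∈proj⇒∈S : ∀ {f X} → X ∈ proj S f → ∣ X ∣ ∈ S
  ∈proj⇒∈S {f} X∈ = proj₂ (∈-filter⁻ ∈S? {xs = f} X∈)

  proj-++ : ∀ {lower upper} → map ∣_∣ lower ≡ U → map ∣_∣ upper ≡ S → proj S (lower ++ upper) ≡ upper
  proj-++ {lower} {upper} lower-type upper-type = begin
    proj S (lower ++ upper)                 ≡⟨ filter-++ ∈S? lower upper ⟩
    filter ∈S? lower ++ filter ∈S? upper    ≡⟨ cong₂ _++_ lower-dropped upper-kept ⟩
    upper                                   ∎
    where
    open ≡-Reasoning
    lower-dropped : filter ∈S? lower ≡ []
    lower-dropped = filter-none ∈S? (All.tabulate (U∉S ∘ ∈-map-≡ lower-type))
    upper-kept : filter ∈S? upper ≡ upper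
    upper-kept = filter-all ∈S? (All.tabulate (∈-map-≡ upper-type))

  record Decomposition (f : List (Subset n)) : Set where
    field
      lower : List (Subset n)
      base : Subset n
      upper : List (Subset n)
      f≡lower++base∷upper : f ≡ lower ++ base ∷ upper
      lower-type : map ∣_∣ lower ≡ U
      upper-type : map ∣_∣ (base ∷ upper) ≡ S

    ∣base∣≡s : ∣ base ∣ ≡ s
    ∣base∣≡s = ∷-injectiveˡ upper-type

    proj≡base∷upper : proj S f ≡ base ∷ upper
    proj≡base∷upper = trans (cong (proj S) f≡lower++base∷upper) (proj-++ lower-type upper-type)

    base∈proj : base ∈ proj S f
    base∈proj = subst (base ∈_) (sym proj≡base∷upper) (here refl)

    base∈f : base ∈ f
    base∈f = subst (base ∈_) (sym f≡lower++base∷upper) (∈-++⁺ʳ lower (here refl))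

  open Decomposition using (base; upper-type; ∣base∣≡s; proj≡base∷upper; base∈proj; base∈f)

  decompose : ∀ {f} → IsFlagOfType n T f → Decomposition f
  decompose (_ , f-type) with map-≡-++ ∣_∣ U (trans f-type T≡U++S)
  ... | lower , base ∷ upper , f≡ , lower-type , upper-type = record
    { lower = lower ; base = base ; upper = upper
    ; f≡lower++base∷upper = f≡ ; lower-type = lower-type ; upper-type = upper-type }

  ⊆base : ∀ {f X} → IsFlagOfType n T f → (d : Decomposition f) → X ∈ f → ∣ X ∣ ∈ U → X ⊆ base d
  ⊆base ((linked , _) , _) d X∈f ∣X∣∈U =
    flag-⊆ linked X∈f (base∈f d) (<⇒≤ (subst (_ <_) (sym (∣base∣≡s d)) (All.lookup U<s ∣X∣∈U)))

  ∈proj⊎⊆base : ∀ {f X} → IsFlagOfType n T f → (d : Decomposition f) → X ∈ f → X ∈ proj S f ⊎ X ⊆ base d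
  ∈proj⊎⊆base {f} {X} f-flag d X∈f with ∈S? X
  ... | yes ∣X∣∈S = inj₁ (∈-filter⁺ ∈S? X∈f ∣X∣∈S)
  ... | no ∣X∣∉S with ∈-++⁻ U (subst (∣ X ∣ ∈_) T≡U++S (∈-map-≡ (proj₂ f-flag) X∈f))
  ...   | inj₁ ∣X∣∈U = inj₂ (⊆base f-flag d X∈f ∣X∣∈U)
  ...   | inj₂ ∣X∣∈S = ⊥-elim (∣X∣∉S ∣X∣∈S)

  GenPos⇒GenPos-proj : ∀ {f g} → GenPos f g → GenPos (proj S f) (proj S g)
  GenPos⇒GenPos-proj {f} {g} gp = All.tabulate λ X∈ → All.tabulate λ Y∈ →
    All.lookup (All.lookup gp (proj₁ (∈-filter⁻ ∈S? {xs = f} X∈))) (proj₁ (∈-filter⁻ ∈S? {xs = g} Y∈))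

  GenPos-proj⇒GenPos : ∀ {f g} → IsFlagOfType n T f → IsFlagOfType n T g →
    GenPos (proj S f) (proj S g) → GenPos f g
  GenPos-proj⇒GenPos {f} {g} f-flag g-flag gp = All.tabulate λ X∈ → All.tabulate λ Y∈ → genPosSet X∈ Y∈
    where
    df = decompose f-flag
    dg = decompose g-flag
    gp-lookup : ∀ {X Y} → X ∈ proj S f → Y ∈ proj S g → GenPosSet X Y
    gp-lookup X∈ Y∈ = All.lookup (All.lookup gp X∈) Y∈
    disjoint-below : ∀ {X X̂ Y Ŷ} → X ⊆ X̂ → Y ⊆ Ŷ → X̂ ∈ proj S f → Ŷ ∈ proj S g →
      ∣ X̂ ∣ ≡ s ⊎ ∣ Ŷ ∣ ≡ s → X ∩ Y ≡ ⊥
    disjoint-below {X̂ = X̂} {Ŷ = Ŷ} X⊆X̂ Y⊆Ŷ X̂∈ Ŷ∈ one-is-s =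
      ⊆-∩-≡⊥ X⊆X̂ Y⊆Ŷ (GenPosSet⇒disjoint (gp-lookup X̂∈ Ŷ∈) (size one-is-s))
      where
      size : ∣ X̂ ∣ ≡ s ⊎ ∣ Ŷ ∣ ≡ s → ∣ X̂ ∣ + ∣ Ŷ ∣ ≤ n
      size (inj₁ ∣X̂∣≡s) = subst (λ k → k + ∣ Ŷ ∣ ≤ n) (sym ∣X̂∣≡s) (All.lookup s+S≤n (∈proj⇒∈S {g} Ŷ∈))
      size (inj₂ ∣Ŷ∣≡s) = subst (λ k → ∣ X̂ ∣ + k ≤ n) (sym ∣Ŷ∣≡s)
        (subst (_≤ n) (+-comm s ∣ X̂ ∣) (All.lookup s+S≤n (∈proj⇒∈S {f} X̂∈)))
    genPosSet : ∀ {X Y} → X ∈ f → Y ∈ g → GenPosSet X Y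
    genPosSet X∈ Y∈ with ∈proj⊎⊆base f-flag df X∈ | ∈proj⊎⊆base g-flag dg Y∈
    ... | inj₁ X∈p | inj₁ Y∈p = gp-lookup X∈p Y∈p
    ... | inj₁ X∈p | inj₂ Y⊆B = inj₂ (disjoint-below ⊆-refl Y⊆B X∈p (base∈proj dg) (inj₂ (∣base∣≡s dg)))
    ... | inj₂ X⊆A | inj₁ Y∈p = inj₂ (disjoint-below X⊆A ⊆-refl (base∈proj df) Y∈p (inj₁ (∣base∣≡s df)))
    ... | inj₂ X⊆A | inj₂ Y⊆B = inj₂ (disjoint-below X⊆A Y⊆B (base∈proj df) (base∈proj dg) (inj₁ (∣base∣≡s df)))

  GenPos⇔GenPos-proj : ∀ f g → IsFlagOfType n T f → IsFlagOfType n T g →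
    GenPos f g ⇔ GenPos (proj S f) (proj S g)
  GenPos⇔GenPos-proj f g f-flag g-flag = mk⇔ GenPos⇒GenPos-proj (GenPos-proj⇒GenPos f-flag g-flag)

  proj-isFlagOfType : ∀ {f} → IsFlagOfType n T f → IsFlagOfType n S (proj S f)
  proj-isFlagOfType f-flag@((linked , proper) , _) =
    (Linked.filter⁺ ∈S? ⊂-trans linked , All.filter⁺ ∈S? proper) ,
    trans (cong flagType (proj≡base∷upper d)) (upper-type d)
    where d = decompose f-flag

  lift : (A : Subset n) → List (Subset n) → List (Subset ∣ A ∣) → List (Subset n)
  lift A p u = map (expand A) u ++ A ∷ p

  fiber : List (Subset n) → List (List (Subset n))
  fiber [] = []
  fiber (A ∷ p) = map (lift A p) (flagsOfType ∣ A ∣ U)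

  c : ℕ
  c = length (flagsOfType s U)

  flagType-expand : ∀ (A : Subset n) (u : List (Subset ∣ A ∣)) → flagType (map (expand A) u) ≡ flagType u
  flagType-expand A u = trans (sym (map-∘ u)) (List.map-cong (∣expand∣ A) u)

  lift-isFlagOfType : ∀ {A p u} → IsFlagOfType n S (A ∷ p) → IsFlagOfType ∣ A ∣ U u →
    IsFlagOfType n T (lift A p u)
  lift-isFlagOfType {A} {p} {u} ((Ap-linked , Ap-proper) , Ap-type) ((u-linked , u-proper) , u-type) =
    (linked , All.++⁺ (All.map⁺ (All.map expand-proper u-proper)) Ap-proper) , type
    where
    expand⊂A : ∀ {Y} → Y ∈ u → expand A Y ⊂ A
    expand⊂A {Y} Y∈ = p⊆q∧∣p∣<∣q∣⇒p⊂q (expand-⊆ A Y)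
      (subst₂ _<_ (sym (∣expand∣ A Y)) (sym (∷-injectiveˡ Ap-type)) (All.lookup U<s (∈-map-≡ u-type Y∈)))
    linked : Linked _⊂_ (lift A p u)
    linked = Linked.AllPairs⇒Linked (AllPairs.++⁺
      (AllPairs.map⁺ (AllPairs.map (expand-⊂⁺ A) (Linked.Linked⇒AllPairs ⊂-trans u-linked)))
      (Linked.Linked⇒AllPairs ⊂-trans Ap-linked)
      (All.map⁺ (All.tabulate λ Y∈ → Linked.Linked⇒All ⊂-trans (expand⊂A Y∈) Ap-linked)))
    expand-proper : ∀ {Y} → Nonempty Y × Y ≢ ⊤ → Nonempty (expand A Y) × expand A Y ≢ ⊤
    expand-proper {Y} (nonempty , _) =
      ∣p∣>0⇒Nonempty (subst (0 <_) (sym (∣expand∣ A Y)) (Nonempty⇒∣p∣>0 nonempty)) ,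
      λ expand≡⊤ → proj₂ (All.lookup Ap-proper (here refl))
        (⊆-antisym (⊆-max A) (subst (_⊆ A) expand≡⊤ (expand-⊆ A Y)))
    type : flagType (lift A p u) ≡ T
    type = begin
      flagType (map (expand A) u ++ A ∷ p)           ≡⟨ map-++ ∣_∣ (map (expand A) u) (A ∷ p) ⟩
      flagType (map (expand A) u) ++ flagType (A ∷ p) ≡⟨ cong₂ _++_ (trans (flagType-expand A u) u-type) Ap-type ⟩
      U ++ S                                          ≡⟨ T≡U++S ⟨
      T                                               ∎
      where open ≡-Reasoning

  fiber-sound : ∀ {p f} → IsFlagOfType n S p → f ∈ fiber p → IsFlagOfType n T f × proj S f ≡ p
  fiber-sound {A ∷ p} p-flag f∈ with ∈-map⁻ (lift A p) f∈
  ... | u , u∈ , refl =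
    lift-isFlagOfType p-flag u-flag , proj-++ (trans (flagType-expand A u) (proj₂ u-flag)) (proj₂ p-flag)
    where
    u-flag : IsFlagOfType ∣ A ∣ U u
    u-flag = ∈-flagsOfType⁻ u∈

  fiber-unique : ∀ p → Unique (fiber p)
  fiber-unique [] = []
  fiber-unique (A ∷ p) = Unique.map⁺ lift-injective (flagsOfType-unique ∣ A ∣ U)
    where
    lift-injective : ∀ {u u′} → lift A p u ≡ lift A p u′ → u ≡ u′
    lift-injective {u} {u′} eq =
      map-injective (expand-injective A) (++-cancelʳ (A ∷ p) (map (expand A) u) (map (expand A) u′) eq)

  fiber-length : ∀ {p} → IsFlagOfType n S p → length (fiber p) ≡ c
  fiber-length {A ∷ p} (_ , Ap-type) =
    trans (length-map (lift A p) (flagsOfType ∣ A ∣ U))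
          (cong (λ k → length (flagsOfType k U)) (∷-injectiveˡ Ap-type))

  fiber-complete : ∀ {f} → IsFlagOfType n T f → f ∈ fiber (proj S f)
  fiber-complete {f} f-flag@((f-linked , f-proper) , _) =
    subst (λ p → f ∈ fiber p) (sym (proj≡base∷upper d))
      (subst (_∈ fiber (A₀ ∷ upper)) (sym f≡lift) (∈-map⁺ (lift A₀ upper) (∈-flagsOfType⁺ u-flag)))
    where
    d = decompose f-flag
    open Decomposition d using (lower; upper; f≡lower++base∷upper; lower-type)
    A₀ : Subset n
    A₀ = base d
    lower⊆f : ∀ {X} → X ∈ lower → X ∈ f
    lower⊆f X∈ = subst (_ ∈_) (sym f≡lower++base∷upper) (∈-++⁺ˡ X∈)
    u : List (Subset ∣ A₀ ∣)
    u = map (compress A₀) lower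
    expand-u : map (expand A₀) u ≡ lower
    expand-u = trans (sym (map-∘ lower)) (trans
      (map-cong-local (All.tabulate λ X∈ →
         expand-compress A₀ _ (⊆base f-flag d (lower⊆f X∈) (∈-map-≡ lower-type X∈))))
      (List.map-id lower))
    f≡lift : f ≡ lift A₀ upper u
    f≡lift = trans f≡lower++base∷upper (cong (_++ A₀ ∷ upper) (sym expand-u))
    u-proper : ∀ {Y} → Y ∈ u → Nonempty Y × Y ≢ ⊤
    u-proper {Y} Y∈u =
      ∣p∣>0⇒Nonempty (subst (0 <_) (∣expand∣ A₀ Y)
        (Nonempty⇒∣p∣>0 (proj₁ (All.lookup f-proper (lower⊆f expand∈lower))))) ,
      ∣p∣<n⇒p≢⊤ (subst₂ _<_ (∣expand∣ A₀ Y) (sym (∣base∣≡s d))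
        (All.lookup U<s (∈-map-≡ lower-type expand∈lower)))
      where
      expand∈lower : expand A₀ Y ∈ lower
      expand∈lower = subst (expand A₀ Y ∈_) expand-u (∈-map⁺ (expand A₀) Y∈u)
    u-flag : IsFlagOfType ∣ A₀ ∣ U u
    u-flag =
      (Linked.map (expand-⊂⁻ A₀) (Linked.map⁻ (subst (Linked _⊂_) (sym expand-u)
         (Linked-++⁻ˡ lower (subst (Linked _⊂_) f≡lower++base∷upper f-linked)))) ,
       All.tabulate u-proper) ,
      trans (sym (flagType-expand A₀ u)) (trans (cong flagType expand-u) lower-type)

  independenceNumber-proj : ∀ {a} → IsAlpha n S a → IsAlpha n T (a * c)
  independenceNumber-proj = independenceNumber-blowUp _≟ᶠ_ _≟ᶠ_
    (λ p≁q → p≁q ∘ GenPos-sym) ≁-refl (proj S) proj-isFlagOfType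
    (λ f-flag g-flag → ¬-cong-⇔ (GenPos⇔GenPos-proj _ _ f-flag g-flag))
    fiber c fiber-length fiber-unique fiber-sound fiber-complete
    where
    ≁-refl : ∀ {p} → IsFlagOfType n S p → ¬ GenPos p p
    ≁-refl {_ ∷ _} (p-flag , _) = ¬GenPos-self p-flag

mainTheorem4 : (n : ℕ) → 2 ≤ n → (S T : List ℕ) →
  IsNatSet S → IsNatSet T →
  All (λ x → 1 ≤ x × x ≤ n ∸ 1) S → All (λ x → 1 ≤ x × x ≤ n ∸ 1) T →
  ¬ (S ≡ []) → ¬ (T ≡ []) → ¬ (S ≡ T) → S ⊆ℕ T →
  minL S + maxL S ≤ n → maxL (T ∖ S) < minL S →
  ((f g : List (Subset n)) → IsFlagOfType n T f → IsFlagOfType n T g →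
     GenPos f g ⇔ GenPos (proj S f) (proj S g)) ×
  (Σ ℕ λ a → Σ ℕ λ c →
     IsAlpha n S a × IsNumVertices (minL S) (T ∖ S) c × IsAlpha n T (a * c))
mainTheorem4 n _ [] _ _ _ _ _ S≢[] _ _ _ _ _ = ⊥-elim (S≢[] refl)
mainTheorem4 n _ S@(s ∷ S′) T sortedS sortedT _ _ _ _ _ S⊆T minS+maxS≤n max[T∖S]<minS =
  GenPos⇔GenPos-proj , a , c , α , count , independenceNumber-proj α
  where
  minS≡s : minL S ≡ s
  minS≡s = minL-Linked< sortedS
  U<s : All (_< s) (T ∖ S)
  U<s = All.tabulate λ u∈ → subst (_ <_) minS≡s (≤-<-trans (≤maxL u∈) max[T∖S]<minS)
  s+S≤n : All (λ x → s + x ≤ n) S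
  s+S≤n = All.tabulate λ x∈ → ≤-trans (+-monoʳ-≤ s (≤maxL x∈)) (subst (λ k → k + maxL S ≤ n) minS≡s minS+maxS≤n)
  T≡U++S : T ≡ (T ∖ S) ++ S
  T≡U++S = Linked<-∖-++ sortedS sortedT S⊆T λ u∈ x∈ → <-≤-trans (All.lookup U<s u∈) (Linked<-least sortedS x∈)
  open Projection n s S′ (T ∖ S) T T≡U++S U<s (All.map <⇒≤ (Linked<-head sortedS)) s+S≤n
    using (GenPos⇔GenPos-proj; c; independenceNumber-proj)
  a : ℕ
  a = proj₁ (independenceNumber-exists n S)
  α : IsAlpha n S a
  α = proj₂ (independenceNumber-exists n S)
  count : IsNumVertices (minL S) (T ∖ S) c
  count = subst (λ k → IsNumVertices k (T ∖ S) c) (sym minS≡s) (flagsOfType-count s (T ∖ S))
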